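{- For any integers $n, m \geq 3$, the super edge-magic deficiency of $P_n + \overline{K_m}$ satisfies \[\left\lceil \tfrac{1}{2}(n-2)(m-1)\right\rceil \leq \mu_s(P_n + \overline{K_m}) \leq (n-1)(m-1)-1.\]
   Context: All graphs are finite and simple. For a graph $G$ with $p=|V(G)|$ vertices and $q=|E(G)|$ edges, a super edge-magic labeling is a bijection $f: V(G)\cup E(G)\to\{1,2,\ldots,p+q\}$ with $f(V(G))=\{1,\ldots,p\}$ such that $f(x)+f(xy)+f(y)$ is the same constant for every edge $xy$; $G$ is super edge-magic if it has such a labeling. The super edge-magic deficiency $\mu_s(G)$ is the minimum nonnegative integer $t$ such that $G\cup tK_1$ (disjoint union of $G$ with $t$ isolated vertices) is super edge-magic, or $+\infty$ if no such $t$ exists. The join $G_1+G_2$ of two vertex-disjoint graphs is their union together with all edges joining a vertex of $G_1$ to a vertex of $G_2$. $P_n$ is the path on $n$ vertices and $\overline{K_m}$ is the graph with $m$ vertices and no edges; so $P_n+\overline{K_m}$ has vertices $u_1,\ldots,u_n,v_1,\ldots,v_m$ and edges $u_iu_{i+1}$ ($1\le i\le n-1$) and $u_iv_j$ ($1\le i\le n$, $1\le j\le m$). -}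

module Defs where

open import Data.Bool using (Bool; true; false; _∧_; _∨_)
open import Data.Nat as ℕ using (ℕ; _+_; _*_; _∸_; _<_)
open import Data.Fin as Fin using (Fin; toℕ; splitAt)
open import Data.Sum using (_⊎_; inj₁; inj₂)
open import Data.Product using (Σ; ∃; _×_; _,_)
open import Relation.Nullary using (¬_)
open import Relation.Nullary.Decidable using (⌊_⌋)
open import Relation.Binary.PropositionalEquality using (_≡_)
open import Function.Bundles using (_⤖_; Bijection)

-- The edges are the unordered pairs {x,y}, represented uniquely as x < y
-- with adj x y ≡ true; hence no loops and no multiple edges by construction.
record Graph : Set where
  field
    p   : ℕ
    adj : Fin p → Fin p → Bool

open Graph public

Edge : Graph → Set
Edge G = Σ (Fin (p G) × Fin (p G)) λ { (x , y) → (x Fin.< y) × (adj G x y ≡ true) }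

VE : Graph → Set
VE G = Fin (p G) ⊎ Edge G

-- A super edge-magic labeling: a bijection f from V(G) ∪ E(G) onto
-- {1,…,N} (encoded as Fin N, label = toℕ + 1; necessarily N = p + q)
-- with f(V(G)) = {1,…,p} (vertices get labels ≤ p; by bijectivity and
-- counting this is exactly f(V) = {1..p}), and a magic constant k with
-- f(x) + f(xy) + f(y) = k for every edge xy.
record SuperEdgeMagicLabeling (G : Graph) : Set where
  field
    N        : ℕ
    f        : VE G ⤖ Fin N
  label : VE G → ℕ
  label z = ℕ.suc (toℕ (Bijection.to f z))
  field
    vertexLabels : ∀ (v : Fin (p G)) → label (inj₁ v) ℕ.≤ p G
    k            : ℕ
    magic        : ∀ (e : Edge G) → let ((x , y) , _) = e in
                   label (inj₁ x) + label (inj₂ e) + label (inj₁ y) ≡ k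

IsSuperEdgeMagic : Graph → Set
IsSuperEdgeMagic G = SuperEdgeMagicLabeling G

_∪K₁_ : Graph → ℕ → Graph
G ∪K₁ t = record { p = p G + t ; adj = a }
  where
  a : Fin (p G + t) → Fin (p G + t) → Bool
  a x y with splitAt (p G) x | splitAt (p G) y
  ... | inj₁ x' | inj₁ y' = adj G x' y'
  ... | _       | _       = false

SuperEdgeMagicDeficiency : Graph → ℕ → Set
SuperEdgeMagicDeficiency G t =
  IsSuperEdgeMagic (G ∪K₁ t) × (∀ s → s < t → ¬ IsSuperEdgeMagic (G ∪K₁ s))

-- P_n + K̄_m : vertices u_1..u_n are Fin n (u_{i+1} ↦ i), v_1..v_m follow.
PathJoinEmpty : ℕ → ℕ → Graph
PathJoinEmpty n m = record { p = n + m ; adj = a }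
  where
  a : Fin (n + m) → Fin (n + m) → Bool
  a x y with splitAt n x | splitAt n y
  ... | inj₁ i | inj₁ j = ⌊ ℕ.suc (toℕ i) ℕ.≟ toℕ j ⌋ ∨ ⌊ ℕ.suc (toℕ j) ℕ.≟ toℕ i ⌋
  ... | inj₁ _ | inj₂ _ = true
  ... | inj₂ _ | inj₁ _ = true
  ... | inj₂ _ | inj₂ _ = false

module Submission where

-- By Figueroa-Centeno et al., a graph is super edge-magic iff its vertices can be labelled
-- 0, …, p - 1 so that the edge sums are distinct and consecutive: the edge labels are then the
-- magic constant minus these sums. This makes the property decidable, so the least t exists, and
-- it bounds the number of edges: sums of two distinct labels lie in [1, 2p - 3], so there are at
-- most 2p - 3 edges. For P_n + K̄_m ∪ tK₁ this says (n - 1) + nm ≤ 2(n + m + t) - 3, that is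
-- (n - 2)(m - 1) ≤ 2t.
--
-- For the upper bound label v₀ by 0, v_{j+1} by (j + 2)n - 1 and u_i by ⌊n/2⌋ + zigzag i, where
-- zigzag permutes 0, …, n - 1 so that zigzag i + zigzag (i + 1) = i + ⌈n/2⌉. The edge sums, less
-- ⌊n/2⌋, then fill [0, n) with the spokes at v₀, [n, 2n - 1) with the path edges and the following
-- blocks of length n with the spokes at v₁, v₂, …. These labels are distinct and below
-- nm = n + m + t for t = (n - 1)(m - 1) - 1, and the isolated vertices take the unused ones.

open import Defs
open import Axiom.UniquenessOfIdentityProofs using (module Decidable⇒UIP)
open import Data.Bool as Bool using (true; _∨_)
import Data.Bool.Properties as Bool
open import Data.Empty using (⊥-elim)
open import Data.Fin as Fin using (Fin; zero; suc; toℕ; fromℕ<; _↑ˡ_; _↑ʳ_; splitAt)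
import Data.Fin.Properties as Fin
open import Data.Fin.Permutation.Components using (transpose; transpose-inverse)
open import Data.Fin.Properties
  using ( toℕ<n; toℕ-injective; toℕ-fromℕ<; toℕ-fromℕ; toℕ-inject; toℕ-inject₁; any?; all?
        ; punchOut-injective; injective⇒≤; join-splitAt; toℕ-↑ˡ; toℕ-↑ʳ; ↑ˡ-injective; ↑ʳ-injective
        ; splitAt-↑ˡ; splitAt-↑ʳ; splitAt⁻¹-↑ˡ; splitAt⁻¹-↑ʳ
        ; toℕ-combine; combine-injectiveˡ; combine-injectiveʳ; combine-surjective )
open import Data.Nat using (ℕ; zero; suc; _+_; _*_; _∸_; _≤_; _<_; ⌊_/2⌋; ⌈_/2⌉; z≤n; s≤s; z<s; s≤s⁻¹)
open import Data.Nat.Properties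
open import Data.Nat.Tactic.RingSolver using (solve-∀)
open import Algebra.Properties.CommutativeSemigroup +-commutativeSemigroup
  using () renaming (xy∙z≈xz∙y to +-rightComm; x∙yz≈y∙xz to x+[y+z]≡y+[x+z])
open import Data.Product using (∃; _×_; _,_; proj₁; proj₂)
open import Data.Product.Properties using (≡-dec)
open import Data.Sum using (_⊎_; inj₁; inj₂; [_,_]′)
open import Data.Sum.Properties using (inj₁-injective; inj₂-injective)
open import Function using (_∘_)
open import Function.Bundles using (_⤖_; Bijection; mk⤖)
open import Function.Construct.Identity using (⤖-id)
open import Function.Construct.Symmetry using (⤖-sym)
open import Function.Consequences.Propositional using (strictlySurjective⇒surjective)
open import Function.Definitions using (Injective; StrictlySurjective)
open import Data.Vec.Functional using (_∷_)
open import Relation.Nullary using (¬_; Dec; yes; no; contradiction)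
open import Relation.Nullary.Decidable
  using (⌊_⌋; map′; _×-dec_; _→-dec_; ¬?; decidable-stable; dec-true; dec-false)
open import Relation.Unary using (Decidable)
open import Relation.Binary.Definitions using (DecidableEquality; tri<; tri≈; tri>)
open import Relation.Binary.PropositionalEquality

private variable
  A B : Set
  a b c k l M : ℕ

n<m+o⇒n∸m<o : a ≤ c → c < a + k → c ∸ a < k
n<m+o⇒n∸m<o {a} {c} {k} a≤c c<a+k = +-cancelˡ-< a _ _ (subst (_< a + k) (sym (m+[n∸m]≡n a≤c)) c<a+k)

record Enumerates {A : Set} (f : A → ℕ) (a k : ℕ) : Set where
  field
    lower     : ∀ x → a ≤ f x
    upper     : ∀ x → f x < a + k
    injective : Injective _≡_ _≡_ f
    onto      : ∀ c → c < k → ∃ λ x → f x ≡ a + c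
open Enumerates

enumerates-0 : {f g : A → ℕ} → Enumerates f a 0 → Enumerates g b 0
enumerates-0 {a = a} e = record
  { lower     = λ x → ⊥-elim (empty x)
  ; upper     = λ x → ⊥-elim (empty x)
  ; injective = λ {x} _ → ⊥-elim (empty x)
  ; onto      = λ _ ()
  }
  where
  empty : ∀ x → _
  empty x = <⇒≱ (upper e x) (≤-trans (≤-reflexive (+-identityʳ a)) (lower e x))

⤖⇒enumerates : (φ : A ⤖ Fin k) → Enumerates (toℕ ∘ Bijection.to φ) 0 k
⤖⇒enumerates φ = record
  { lower     = λ _ → z≤n
  ; upper     = λ x → toℕ<n (Bijection.to φ x)
  ; injective = Bijection.injective φ ∘ toℕ-injective
  ; onto      = λ c c<k → let (x , to-x) = Bijection.strictlySurjective φ (fromℕ< c<k)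
                          in x , trans (cong toℕ to-x) (toℕ-fromℕ< c<k)
  }

module _ {f : A → ℕ} (e : Enumerates f a k) where

  private
    offset< : ∀ x → f x ∸ a < k
    offset< x = n<m+o⇒n∸m<o (lower e x) (upper e x)

  enumerates⇒⤖ : A ⤖ Fin k
  enumerates⇒⤖ = mk⤖ (index-injective , strictlySurjective⇒surjective index-onto)
    where
    index : A → Fin k
    index x = fromℕ< (offset< x)
    index-injective : Injective _≡_ _≡_ index
    index-injective {x} {y} eq = injective e (∸-cancelʳ-≡ (lower e x) (lower e y) (begin
      f x ∸ a             ≡⟨ toℕ-fromℕ< (offset< x) ⟨
      toℕ (index x)       ≡⟨ cong toℕ eq ⟩
      toℕ (index y)       ≡⟨ toℕ-fromℕ< (offset< y) ⟩
      f y ∸ a             ∎))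
      where open ≡-Reasoning
    index-onto : StrictlySurjective _≡_ index
    index-onto i = let (x , fx) = onto e (toℕ i) (toℕ<n i) in
      x , toℕ-injective (trans (toℕ-fromℕ< (offset< x)) (trans (cong (_∸ a) fx) (m+n∸m≡n a (toℕ i))))

  toℕ-enumerates⇒⤖ : ∀ x → toℕ (Bijection.to enumerates⇒⤖ x) ≡ f x ∸ a
  toℕ-enumerates⇒⤖ x = toℕ-fromℕ< (offset< x)

enumerates-transport : {f : A → ℕ} {g : B → ℕ} (φ : A ⤖ B) → (∀ x → g (Bijection.to φ x) ≡ f x) →
               Enumerates f a k → Enumerates g a k
enumerates-transport {A = A} {B = B} {f = f} {g} φ g∘φ≡f e = record
  { lower     = λ y → subst (_ ≤_) (sym (g≡f∘φ⁻ y)) (lower e (φ⁻ y))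
  ; upper     = λ y → subst (_< _) (sym (g≡f∘φ⁻ y)) (upper e (φ⁻ y))
  ; injective = λ {y} {y'} gy≡gy' → trans (sym (φ∘φ⁻ y)) (trans
                  (cong (Bijection.to φ) (injective e (trans (sym (g≡f∘φ⁻ y)) (trans gy≡gy' (g≡f∘φ⁻ y')))))
                  (φ∘φ⁻ y'))
  ; onto      = λ c c<k → let (x , fx) = onto e c c<k in Bijection.to φ x , trans (g∘φ≡f x) fx
  }
  where
  φ⁻ : B → A
  φ⁻ y = proj₁ (Bijection.strictlySurjective φ y)
  φ∘φ⁻ : ∀ y → Bijection.to φ (φ⁻ y) ≡ y
  φ∘φ⁻ y = proj₂ (Bijection.strictlySurjective φ y)
  g≡f∘φ⁻ : ∀ y → g y ≡ f (φ⁻ y)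
  g≡f∘φ⁻ y = trans (cong g (sym (φ∘φ⁻ y))) (g∘φ≡f (φ⁻ y))

enumerates-+ʳ : {f : A → ℕ} → Enumerates f a k → Enumerates (λ x → f x + c) (a + c) k
enumerates-+ʳ {a = a} {k} {c} {f} e = record
  { lower     = λ x → +-monoˡ-≤ c (lower e x)
  ; upper     = λ x → subst (f x + c <_) (+-rightComm a k c) (+-monoˡ-< c (upper e x))
  ; injective = λ eq → injective e (+-cancelʳ-≡ c _ _ eq)
  ; onto      = λ d d<k → let (x , fx) = onto e d d<k in
                  x , trans (cong (_+ c) fx) (+-rightComm a d c)
  }

enumerates-⊎ : {f : A → ℕ} {g : B → ℕ} → Enumerates f a k → Enumerates g (a + k) l →
               Enumerates [ f , g ]′ a (k + l)
enumerates-⊎ {a = a} {k} {l} {f = f} {g} ef eg = record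
  { lower     = λ { (inj₁ x) → lower ef x ; (inj₂ y) → ≤-trans (m≤m+n a k) (lower eg y) }
  ; upper     = λ { (inj₁ x) → <-≤-trans (upper ef x) (+-monoʳ-≤ a (m≤m+n k l))
                  ; (inj₂ y) → subst (g y <_) (+-assoc a k l) (upper eg y) }
  ; injective = λ { {inj₁ x} {inj₁ x'} eq → cong inj₁ (injective ef eq)
                  ; {inj₁ x} {inj₂ y}  eq → ⊥-elim (separated x y eq)
                  ; {inj₂ y} {inj₁ x}  eq → ⊥-elim (separated x y (sym eq))
                  ; {inj₂ y} {inj₂ y'} eq → cong inj₂ (injective eg eq) }
  ; onto      = onto-⊎
  }
  where
  separated : ∀ x y → f x ≢ g y
  separated x y eq = <⇒≱ (upper ef x) (subst (a + k ≤_) (sym eq) (lower eg y))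
  onto-⊎ : ∀ c → c < k + l → ∃ λ z → [ f , g ]′ z ≡ a + c
  onto-⊎ c c<k+l with c <? k
  ... | yes c<k = let (x , fx) = onto ef c c<k in inj₁ x , fx
  ... | no c≮k  = let k≤c = ≮⇒≥ c≮k
                      (y , gy) = onto eg (c ∸ k) (n<m+o⇒n∸m<o k≤c c<k+l)
                  in inj₂ y , trans gy (trans (+-assoc a k (c ∸ k)) (cong (a +_) (m+[n∸m]≡n k≤c)))

enumerates-⊎⁻ʳ : {f : A → ℕ} {g : B → ℕ} → Enumerates [ f , g ]′ a k → Enumerates f a l →
                Enumerates g (a + l) (k ∸ l)
enumerates-⊎⁻ʳ {a = a} {k} {l} {f = f} {g} efg ef = record
  { lower     = lower-g
  ; upper     = λ y → <-≤-trans (upper efg (inj₂ y))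
                        (≤-trans (+-monoʳ-≤ a (m≤n+m∸n k l)) (≤-reflexive (sym (+-assoc a l (k ∸ l)))))
  ; injective = λ eq → inj₂-injective (injective efg eq)
  ; onto      = onto-g
  }
  where
  lower-g : ∀ y → a + l ≤ g y
  lower-g y with a + l ≤? g y
  ... | yes a+l≤gy = a+l≤gy
  ... | no  a+l≰gy =
    let a≤gy = lower efg (inj₂ y)
        (x , fx) = onto ef (g y ∸ a) (n<m+o⇒n∸m<o a≤gy (≰⇒> a+l≰gy))
    in contradiction (injective efg {inj₁ x} {inj₂ y} (trans fx (m+[n∸m]≡n a≤gy))) λ ()
  l+c<k : ∀ c → c < k ∸ l → l + c < k
  l+c<k c c<k∸l = <-≤-trans (+-monoʳ-< l c<k∸l) (≤-reflexive (m+[n∸m]≡n l≤k))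
    where
    l≤k : l ≤ k
    l≤k = <⇒≤ (m∸n≢0⇒n<m λ k∸l≡0 → contradiction (subst (c <_) k∸l≡0 c<k∸l) λ ())
  onto-g : ∀ c → c < k ∸ l → ∃ λ y → g y ≡ a + l + c
  onto-g c c<k∸l with onto efg (l + c) (l+c<k c c<k∸l)
  ... | inj₁ x , fx =
    ⊥-elim (<⇒≱ (upper ef x) (≤-trans (m≤m+n (a + l) c) (≤-reflexive (trans (+-assoc a l c) (sym fx)))))
  ... | inj₂ y , gy = y , trans gy (sym (+-assoc a l c))

enumerates-reverse : {f g : A → ℕ} → (∀ x → suc (f x + g x) ≡ a + k + b) →
                     Enumerates f a k → Enumerates g b k
enumerates-reverse {a = a} {k} {b} {f} {g} sum e = record
  { lower     = λ x → +-cancelˡ-≤ (a + k) b (g x) (subst (_≤ a + k + g x) (sum x) (+-monoˡ-≤ (g x) (upper e x)))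
  ; upper     = λ x → +-cancelˡ-≤ a (suc (g x)) (b + k) (begin
                  a + suc (g x)     ≤⟨ +-monoˡ-≤ (suc (g x)) (lower e x) ⟩
                  f x + suc (g x)   ≡⟨ +-suc (f x) (g x) ⟩
                  suc (f x + g x)   ≡⟨ sum x ⟩
                  a + k + b         ≡⟨ +-assoc a k b ⟩
                  a + (k + b)       ≡⟨ cong (a +_) (+-comm k b) ⟩
                  a + (b + k)       ∎)
  ; injective = λ {x} {y} gx≡gy → injective e (+-cancelʳ-≡ (g x) (f x) (f y)
                  (trans (suc-injective (trans (sum x) (sym (sum y)))) (cong (f y +_) (sym gx≡gy))))
  ; onto      = onto-g
  }
  where
  open ≤-Reasoning
  onto-g : ∀ c → c < k → ∃ λ x → g x ≡ b + c
  onto-g c c<k = x , suc-injective (+-cancelˡ-≡ (a + c') (suc (g x)) (suc (b + c)) (begin-equality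
      a + c' + suc (g x)     ≡⟨ +-suc (a + c') (g x) ⟩
      suc (a + c' + g x)     ≡⟨ cong (λ t → suc (t + g x)) fx ⟨
      suc (f x + g x)        ≡⟨ sum x ⟩
      a + k + b              ≡⟨ cong (λ t → a + t + b) (m∸n+n≡m c<k) ⟨
      a + (c' + suc c) + b   ≡⟨ rearrange a c' c b ⟩
      a + c' + suc (b + c)   ∎))
    where
    c' = k ∸ suc c
    x = proj₁ (onto e c' (∸-monoʳ-< z<s c<k))
    fx = proj₂ (onto e c' (∸-monoʳ-< z<s c<k))
    rearrange : ∀ a c' c b → a + (c' + suc c) + b ≡ a + c' + suc (b + c)
    rearrange = solve-∀

enumerates-complement : {f g : A → ℕ} → (∀ x y → f x + g x ≡ f y + g y) →
                        Enumerates f a k → ∃ λ b → Enumerates g b k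
enumerates-complement {k = zero} _ e = 0 , enumerates-0 e
enumerates-complement {a = a} {k = suc k} {f} {g} constant e =
  g top , enumerates-reverse (λ x → begin
    suc (f x + g x)       ≡⟨ cong suc (constant x top) ⟩
    suc (f top + g top)   ≡⟨ cong (λ t → suc (t + g top)) f-top ⟩
    suc (a + k + g top)   ≡⟨ cong (_+ g top) (+-suc a k) ⟨
    a + suc k + g top     ∎) e
  where
  open ≡-Reasoning
  top = proj₁ (onto e k ≤-refl)
  f-top = proj₂ (onto e k ≤-refl)

enumerates-below : {f : A → ℕ} → Enumerates f a k → (∀ x → f x < M) →
                   ∃ λ a' → a' + k ≤ M × Enumerates f a' k
enumerates-below {k = zero} e _ = 0 , z≤n , enumerates-0 e
enumerates-below {a = a} {k = suc k} {M} e f<M =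
  let (top , f-top) = onto e k ≤-refl
  in a , subst (_≤ M) (trans (cong suc f-top) (sym (+-suc a k))) (f<M top) , e

toℕ-enumerates : Enumerates (toℕ {k}) 0 k
toℕ-enumerates {k} = ⤖⇒enumerates (⤖-id (Fin k))

enumerates-resp : {f g : A → ℕ} → (∀ x → g x ≡ f x) → Enumerates f a k → Enumerates g a k
enumerates-resp {A = A} = enumerates-transport (⤖-id A)

injective⇒strictlySurjective : {h : Fin k → Fin k} → Injective _≡_ _≡_ h → StrictlySurjective _≡_ h
injective⇒strictlySurjective {suc k} {h} h-injective y with any? (λ x → h x Fin.≟ y)
... | yes hit  = hit
... | no  miss = contradiction (injective⇒≤ squeeze-injective) 1+n≰n
  where
  squeeze : Fin (suc k) → Fin k
  squeeze x = Fin.punchOut {i = y} {j = h x} (λ y≡hx → miss (x , sym y≡hx))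
  squeeze-injective : Injective _≡_ _≡_ squeeze
  squeeze-injective eq = h-injective (punchOut-injective {i = y} _ _ eq)

injective⇒enumerates : {f : Fin k → ℕ} → (∀ i → f i < k) → Injective _≡_ _≡_ f → Enumerates f 0 k
injective⇒enumerates {k} {f} f<k f-injective = record
  { lower     = λ _ → z≤n
  ; upper     = f<k
  ; injective = f-injective
  ; onto      = λ c c<k → let (x , hx) = injective⇒strictlySurjective h-injective (fromℕ< c<k) in
                  x , trans (sym (toℕ-fromℕ< (f<k x))) (trans (cong toℕ hx) (toℕ-fromℕ< c<k))
  }
  where
  h : Fin k → Fin k
  h i = fromℕ< (f<k i)
  h-injective : Injective _≡_ _≡_ h
  h-injective {i} {j} eq =
    f-injective (trans (sym (toℕ-fromℕ< (f<k i))) (trans (cong toℕ eq) (toℕ-fromℕ< (f<k j))))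

enumerates-× : {f : A → ℕ} {g : B → ℕ} → Enumerates f 0 k → Enumerates g 0 l →
               Enumerates (λ (x , y) → f x + k * g y) 0 (l * k)
enumerates-× {A = A} {B = B} {k} {l} {f} {g} ef eg =
  enumerates-resp digits-value (⤖⇒enumerates (mk⤖ (digits-injective , strictlySurjective⇒surjective digits-onto)))
  where
  ψ = enumerates⇒⤖ ef
  χ = enumerates⇒⤖ eg
  digits : A × B → Fin (l * k)
  digits (x , y) = Fin.combine (Bijection.to χ y) (Bijection.to ψ x)
  digits-injective : Injective _≡_ _≡_ digits
  digits-injective eq = cong₂ _,_ (Bijection.injective ψ (combine-injectiveʳ {l} _ _ _ _ eq))
                                  (Bijection.injective χ (combine-injectiveˡ {l} _ _ _ _ eq))
  digits-onto : StrictlySurjective _≡_ digits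
  digits-onto i = let (j , l , jl≡i) = combine-surjective {l} i
                      (y , χy) = Bijection.strictlySurjective χ j
                      (x , ψx) = Bijection.strictlySurjective ψ l
                  in (x , y) , trans (cong₂ Fin.combine χy ψx) jl≡i
  digits-value : ∀ xy → f (proj₁ xy) + k * g (proj₂ xy) ≡ toℕ (digits xy)
  digits-value (x , y) = sym (trans (toℕ-combine (Bijection.to χ y) (Bijection.to ψ x))
    (trans (cong₂ (λ s t → k * s + t) (toℕ-enumerates⇒⤖ eg y) (toℕ-enumerates⇒⤖ ef x))
           (+-comm (k * g y) (f x))))

injective? : ∀ {l} (h : Fin k → Fin l) → Dec (Injective _≡_ _≡_ h)
injective? h = map′ (λ h-inj {x} {y} → h-inj x y) (λ h-inj x y → h-inj)
  (all? λ x → all? λ y → (h x Fin.≟ h y) →-dec (x Fin.≟ y))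

-- Q must respect ≗ because a function is recovered from its table of values only pointwise.
any-function? : ∀ d {Q : (Fin d → Fin k) → Set} → (∀ {L L'} → L ≗ L' → Q L → Q L') →
                (∀ L → Dec (Q L)) → Dec (∃ Q)
any-function? zero    resp Q? = map′ (λ q → empty , q) (λ (L , q) → resp (λ ()) q) (Q? empty)
  where
  empty : Fin 0 → Fin _
  empty ()
any-function? (suc d) resp Q? =
  map′ (λ (v , L , q) → v ∷ L , q)
       (λ (L , q) → L zero , L ∘ suc , resp (λ { zero → refl ; (suc i) → refl }) q)
       (any? λ v → any-function? d (λ L≗L' → resp (λ { zero → refl ; (suc i) → L≗L' i })) (Q? ∘ (v ∷_)))

edgeSum : (G : Graph) → (Fin (p G) → ℕ) → Edge G → ℕ
edgeSum G ℓ ((x , y) , _) = ℓ x + ℓ y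

module _ {G : Graph} where

  edge-≡ : {e e' : Edge G} → proj₁ e ≡ proj₁ e' → e ≡ e'
  edge-≡ {_ , x<y , xy} {_ , x<y' , xy'} refl =
    cong₂ (λ lt a → _ , lt , a) (<-irrelevant x<y x<y') (Decidable⇒UIP.≡-irrelevant Bool._≟_ xy xy')

  _≟-edge_ : DecidableEquality (Edge G)
  e ≟-edge e' = map′ edge-≡ (cong proj₁) (≡-dec Fin._≟_ Fin._≟_ (proj₁ e) (proj₁ e'))

  private
    isEdge? : ∀ x y → Dec (x Fin.< y × adj G x y ≡ true)
    isEdge? x y = (x Fin.<? y) ×-dec (adj G x y Bool.≟ true)

  all-edges? : {Q : Edge G → Set} → Decidable Q → Dec (∀ e → Q e)
  all-edges? {Q} Q? = map′ (λ h ((x , y) , xy) → h x y xy) (λ h x y xy → h ((x , y) , xy))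
    (all? λ x → all? λ y → at x y)
    where
    at : ∀ x y → Dec (∀ xy → Q ((x , y) , xy))
    at x y with isEdge? x y
    ... | no  ¬xy = yes λ xy → contradiction xy ¬xy
    ... | yes xy  = map′ (λ q xy' → subst Q (edge-≡ refl) q) (λ h → h xy) (Q? ((x , y) , xy))

  any-edge? : {Q : Edge G → Set} → Decidable Q → Dec (∃ Q)
  any-edge? {Q} Q? = map′ (λ (x , y , xy , q) → ((x , y) , xy) , q) (λ (((x , y) , xy) , q) → x , y , xy , q)
    (any? λ x → any? λ y → at x y)
    where
    at : ∀ x y → Dec (∃ λ xy → Q ((x , y) , xy))
    at x y with isEdge? x y
    ... | no  ¬xy = no λ (xy , _) → contradiction xy ¬xy
    ... | yes xy  = map′ (xy ,_) (λ (xy' , q) → subst Q (edge-≡ refl) q) (Q? ((x , y) , xy))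

  enumerates? : (f : Edge G → ℕ) → ∀ a k → Dec (Enumerates f a k)
  enumerates? f a k = map′
    (λ (l , u , i , o) → record { lower = l ; upper = u ; injective = λ {e} {e'} → i e e' ; onto = λ c → o {c} })
    (λ e → lower e , upper e , (λ _ _ → injective e) , λ {c} → onto e c)
    (all-edges? (λ e → a ≤? f e) ×-dec all-edges? (λ e → f e <? a + k)
      ×-dec all-edges? (λ e → all-edges? λ e' → (f e ≟ f e') →-dec (e ≟-edge e'))
      ×-dec allUpTo? (λ c → any-edge? λ e → f e ≟ a + c) k)

-- The characterisation of super edge-magic graphs by Figueroa-Centeno et al., with labels
-- counted from 0; the bound only serves to make the search for such labellings finite.
record ConsecutiveSums (G : Graph) (label : Fin (p G) → Fin (p G)) : Set where
  field
    label-injective : Injective _≡_ _≡_ label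
    lowest count    : ℕ
    bounded         : lowest + count ≤ p G + p G
    sums            : Enumerates (edgeSum G (toℕ ∘ label)) lowest count

module _ {G : Graph} where

  consecutiveSums : {L : Fin (p G) → Fin (p G)} → Injective _≡_ _≡_ L →
                    Enumerates (edgeSum G (toℕ ∘ L)) a k → ConsecutiveSums G L
  consecutiveSums {L = L} L-injective e =
    let (s , bounded , e′) = enumerates-below e λ ((x , y) , _) → +-mono-< (toℕ<n (L x)) (toℕ<n (L y))
    in record { label-injective = L-injective ; lowest = s ; count = _ ; bounded = bounded ; sums = e′ }

  consecutiveSums-resp : {L L' : Fin (p G) → Fin (p G)} → L ≗ L' → ConsecutiveSums G L → ConsecutiveSums G L'
  consecutiveSums-resp L≗L' cs = record
    { label-injective = λ eq → label-injective (trans (L≗L' _) (trans eq (sym (L≗L' _))))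
    ; lowest          = lowest
    ; count           = count
    ; bounded         = bounded
    ; sums            = enumerates-resp (λ ((x , y) , _) → sym (cong₂ (λ u v → toℕ u + toℕ v) (L≗L' x) (L≗L' y)))
                                        sums
    }
    where open ConsecutiveSums cs

  consecutiveSums? : (L : Fin (p G) → Fin (p G)) → Dec (ConsecutiveSums G L)
  consecutiveSums? L = map′ fromSearch toSearch
    (injective? L ×-dec
      anyUpTo? (λ s → anyUpTo? (λ q → (s + q ≤? bound) ×-dec enumerates? _ s q) (suc bound)) (suc bound))
    where
    bound = p G + p G
    Search = Injective _≡_ _≡_ L ×
             ∃ λ s → s < suc bound × ∃ λ q → q < suc bound ×
                     s + q ≤ bound × Enumerates (edgeSum G (toℕ ∘ L)) s q
    fromSearch : Search → ConsecutiveSums G L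
    fromSearch (L-injective , s , _ , q , _ , bounded , e) = record
      { label-injective = L-injective ; lowest = s ; count = q ; bounded = bounded ; sums = e }
    toSearch : ConsecutiveSums G L → Search
    toSearch cs = label-injective , lowest , s≤s (≤-trans (m≤m+n lowest count) bounded) ,
                  count , s≤s (≤-trans (m≤n+m count lowest) bounded) , bounded , sums
      where open ConsecutiveSums cs

  consecutiveSums⇒superEdgeMagic : {L : Fin (p G) → Fin (p G)} → ConsecutiveSums G L → IsSuperEdgeMagic G
  consecutiveSums⇒superEdgeMagic {L} cs = record
    { N            = p G + count
    ; f            = φ
    ; vertexLabels = λ x → subst (λ t → suc t ≤ p G) (sym (toℕ-enumerates⇒⤖ labels (inj₁ x))) (toℕ<n (L x))
    ; k            = lowest + count + p G + 2
    ; magic        = magic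
    }
    where
    open ConsecutiveSums cs
    S = edgeSum G (toℕ ∘ L)
    -- edges are labelled in decreasing order of their sums, above the vertices
    edgeLabel : Edge G → ℕ
    edgeLabel e = lowest + count + p G ∸ suc (S e)
    sum-edgeLabel : ∀ e → suc (S e + edgeLabel e) ≡ lowest + count + p G
    sum-edgeLabel e = m+[n∸m]≡n (≤-trans (upper sums e) (m≤m+n (lowest + count) (p G)))
    labels : Enumerates [ toℕ ∘ L , edgeLabel ]′ 0 (p G + count)
    labels = enumerates-⊎ (injective⇒enumerates (λ x → toℕ<n (L x)) (label-injective ∘ toℕ-injective))
                          (enumerates-reverse sum-edgeLabel sums)
    φ = enumerates⇒⤖ labels
    index : VE G → ℕ
    index z = toℕ (Bijection.to φ z)
    magic : ∀ (e : Edge G) → let ((x , y) , _) = e in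
            suc (index (inj₁ x)) + suc (index (inj₂ e)) + suc (index (inj₁ y)) ≡ lowest + count + p G + 2
    magic e@((x , y) , _) rewrite toℕ-enumerates⇒⤖ labels (inj₁ x)
                                | toℕ-enumerates⇒⤖ labels (inj₂ e)
                                | toℕ-enumerates⇒⤖ labels (inj₁ y) =
      trans (rearrange (toℕ (L x)) (edgeLabel e) (toℕ (L y))) (cong (_+ 2) (sum-edgeLabel e))
      where
      rearrange : ∀ u v w → suc u + suc v + suc w ≡ suc (u + w + v) + 2
      rearrange = solve-∀

  superEdgeMagic⇒consecutiveSums : IsSuperEdgeMagic G → ∃ (ConsecutiveSums G)
  superEdgeMagic⇒consecutiveSums sem = L , consecutiveSums L-injective (enumerates-resp edgeSum-L sums)
    where
    open SuperEdgeMagicLabeling sem hiding (k)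
    T : VE G → ℕ
    T = toℕ ∘ Bijection.to f
    L : Fin (p G) → Fin (p G)
    L x = fromℕ< (vertexLabels x)
    all : Enumerates [ T ∘ inj₁ , T ∘ inj₂ ]′ 0 N
    all = enumerates-resp (λ { (inj₁ _) → refl ; (inj₂ _) → refl }) (⤖⇒enumerates f)
    vertices : Enumerates (T ∘ inj₁) 0 (p G)
    vertices = injective⇒enumerates vertexLabels (inj₁-injective ∘ injective all)
    edges : Enumerates (T ∘ inj₂) (p G) (N ∸ p G)
    edges = enumerates-⊎⁻ʳ all vertices
    constant : ∀ e e' → T (inj₂ e) + edgeSum G (T ∘ inj₁) e ≡ T (inj₂ e') + edgeSum G (T ∘ inj₁) e'
    constant e e' = +-cancelʳ-≡ 3 _ _ (trans (magic-sum e) (sym (magic-sum e')))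
      where
      rearrange : ∀ u v w → v + (u + w) + 3 ≡ suc u + suc v + suc w
      rearrange = solve-∀
      magic-sum : ∀ e → T (inj₂ e) + edgeSum G (T ∘ inj₁) e + 3 ≡ SuperEdgeMagicLabeling.k sem
      magic-sum e@((x , y) , _) = trans (rearrange (T (inj₁ x)) (T (inj₂ e)) (T (inj₁ y))) (magic e)
    sums = proj₂ (enumerates-complement constant edges)
    edgeSum-L : ∀ e → edgeSum G (toℕ ∘ L) e ≡ edgeSum G (T ∘ inj₁) e
    edgeSum-L ((x , y) , _) = cong₂ _+_ (toℕ-fromℕ< (vertexLabels x)) (toℕ-fromℕ< (vertexLabels y))
    L-injective : Injective _≡_ _≡_ L
    L-injective {x} {y} eq = injective vertices (trans (sym (toℕ-fromℕ< (vertexLabels x)))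
                                                (trans (cong toℕ eq) (toℕ-fromℕ< (vertexLabels y))))

superEdgeMagic? : (G : Graph) → Dec (IsSuperEdgeMagic G)
superEdgeMagic? G = map′ (consecutiveSums⇒superEdgeMagic ∘ proj₂) superEdgeMagic⇒consecutiveSums
  (any-function? (p G) consecutiveSums-resp consecutiveSums?)

increasing-sum-bounds : a < b → b < M → 0 < a + b × a + b + 3 ≤ M + M
increasing-sum-bounds {a} {b} {M} a<b b<M = <-≤-trans (≤-<-trans z≤n a<b) (m≤n+m b a) , (begin
  a + b + 3             ≡⟨ rearrange a b ⟩
  suc (suc a) + suc b   ≤⟨ +-mono-≤ (≤-trans (s≤s a<b) b<M) b<M ⟩
  M + M                 ∎)
  where
  open ≤-Reasoning
  rearrange : ∀ a b → a + b + 3 ≡ suc (suc a) + suc b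
  rearrange = solve-∀

distinct-sum-bounds : a < M → b < M → a ≢ b → 0 < a + b × a + b + 3 ≤ M + M
distinct-sum-bounds {a} {M} {b} a<M b<M a≢b with <-cmp a b
... | tri< a<b _ _ = increasing-sum-bounds a<b b<M
... | tri≈ _ a≡b _ = contradiction a≡b a≢b
... | tri> _ _ b<a = subst (λ t → 0 < t × t + 3 ≤ M + M) (+-comm b a) (increasing-sum-bounds b<a a<M)

superEdgeMagic⇒edges≤ : {G : Graph} → IsSuperEdgeMagic G →
                        (h : Fin (suc k) → Edge G) → Injective _≡_ _≡_ h → suc k + 3 ≤ p G + p G
superEdgeMagic⇒edges≤ {k} {G} sem h h-injective with superEdgeMagic⇒consecutiveSums sem
... | L , cs = go count sums k<count
  where
  open ConsecutiveSums cs
  S = edgeSum G (toℕ ∘ L)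
  k<count : suc k ≤ count
  k<count = injective⇒≤ {f = Bijection.to (enumerates⇒⤖ sums) ∘ h}
                        (h-injective ∘ Bijection.injective (enumerates⇒⤖ sums))
  edgeSum-bounds : ∀ e → 0 < S e × S e + 3 ≤ p G + p G
  edgeSum-bounds ((x , y) , x<y , _) =
    distinct-sum-bounds (toℕ<n (L x)) (toℕ<n (L y)) (λ eq → Fin.<⇒≢ x<y (label-injective (toℕ-injective eq)))
  go : ∀ q → Enumerates S lowest q → suc k ≤ q → suc k + 3 ≤ p G + p G
  go (suc q) e k<q = let (bottom , S-bottom) = onto e 0 z<s
                         (top , S-top) = onto e q ≤-refl
                         0<lowest = subst (0 <_) (trans S-bottom (+-identityʳ lowest)) (proj₁ (edgeSum-bounds bottom))
                     in begin
    suc k + 3        ≤⟨ +-monoˡ-≤ 3 k<q ⟩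
    suc q + 3        ≤⟨ +-monoˡ-≤ 3 (+-monoˡ-≤ q 0<lowest) ⟩
    lowest + q + 3   ≡⟨ cong (_+ 3) S-top ⟨
    S top + 3        ≤⟨ proj₂ (edgeSum-bounds top) ⟩
    p G + p G        ∎
    where open ≤-Reasoning

least : {Q : ℕ → Set} → Decidable Q → ∀ {t} → Q t →
        ∃ λ μ → μ ≤ t × Q μ × (∀ s → s < μ → ¬ Q s)
least {Q} Q? {t} Qt with Fin.¬∀⟶∃¬-smallest (suc t) (λ i → ¬ Q (toℕ i)) (λ i → ¬? (Q? (toℕ i)))
                           (λ none → none (Fin.fromℕ t) (subst Q (sym (toℕ-fromℕ t)) Qt))
... | μ , ¬¬Qμ , below = toℕ μ , s≤s⁻¹ (toℕ<n μ) , decidable-stable (Q? (toℕ μ)) ¬¬Qμ , λ s s<μ →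
  subst (¬_ ∘ Q) (trans (toℕ-inject (fromℕ< s<μ)) (toℕ-fromℕ< s<μ)) (below (fromℕ< s<μ))

data Parity : ℕ → Set where
  even : ∀ r → Parity (r + r)
  odd  : ∀ r → Parity (suc (r + r))

parity : ∀ i → Parity i
parity zero    = even 0
parity (suc i) with parity i
... | even r = odd r
... | odd r  = subst Parity (cong suc (+-suc r r)) (even (suc r))

double<⇒<⌈/2⌉ : ∀ {n} r → r + r < n → r < ⌈ n /2⌉
double<⇒<⌈/2⌉ {n} r 2r<n = subst (_≤ ⌈ n /2⌉) (cong suc (sym (n≡⌊n+n/2⌋ r))) (⌈n/2⌉-mono 2r<n)

double+1<⇒<⌊/2⌋ : ∀ {n} r → suc (r + r) < n → r < ⌊ n /2⌋
double+1<⇒<⌊/2⌋ {n} r 2r+1<n = subst (_≤ ⌊ n /2⌋) (cong suc (sym (n≡⌊n+n/2⌋ r))) (⌊n/2⌋-mono 2r+1<n)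

zigzag : ℕ → ℕ → ℕ
zigzag h zero          = zero
zigzag h (suc zero)    = h
zigzag h (suc (suc i)) = suc (zigzag h i)

zigzag-+-suc : ∀ h i → zigzag h i + zigzag h (suc i) ≡ i + h
zigzag-+-suc h zero          = refl
zigzag-+-suc h (suc zero)    = +-comm h 1
zigzag-+-suc h (suc (suc i)) = cong suc (trans (+-suc (zigzag h i) (zigzag h (suc i))) (cong suc (zigzag-+-suc h i)))

zigzag-even : ∀ h r → zigzag h (r + r) ≡ r
zigzag-even h zero    = refl
zigzag-even h (suc r) rewrite +-suc r r = cong suc (zigzag-even h r)

zigzag-odd : ∀ h r → zigzag h (suc (r + r)) ≡ h + r
zigzag-odd h zero    = sym (+-identityʳ h)
zigzag-odd h (suc r) rewrite +-suc r r | +-suc h r = cong suc (zigzag-odd h r)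

module _ (n : ℕ) where

  private
    h = ⌈ n /2⌉

  zigzag< : ∀ i → i < n → zigzag h i < n
  zigzag< i i<n with parity i
  ... | even r rewrite zigzag-even h r = <-≤-trans (double<⇒<⌈/2⌉ r i<n) (⌈n/2⌉≤n n)
  ... | odd r  rewrite zigzag-odd h r  =
    subst (h + r <_) (trans (+-comm h ⌊ n /2⌋) (⌊n/2⌋+⌈n/2⌉≡n n)) (+-monoʳ-< h (double+1<⇒<⌊/2⌋ r i<n))

  zigzag-injective : ∀ i j → i < n → j < n → zigzag h i ≡ zigzag h j → i ≡ j
  zigzag-injective i j i<n j<n eq with parity i | parity j
  ... | even r | even s rewrite zigzag-even h r | zigzag-even h s = cong (λ t → t + t) eq
  ... | odd r  | odd s  rewrite zigzag-odd h r  | zigzag-odd h s  = cong (λ t → suc (t + t)) (+-cancelˡ-≡ h r s eq)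
  ... | even r | odd s  rewrite zigzag-even h r | zigzag-odd h s  =
    contradiction (subst (h ≤_) (sym eq) (m≤m+n h s)) (<⇒≱ (double<⇒<⌈/2⌉ r i<n))
  ... | odd r  | even s rewrite zigzag-odd h r  | zigzag-even h s =
    contradiction (subst (h ≤_) eq (m≤m+n h r)) (<⇒≱ (double<⇒<⌈/2⌉ s j<n))

  zigzag-enumerates : Enumerates (zigzag h ∘ toℕ {n}) 0 n
  zigzag-enumerates = injective⇒enumerates (λ i → zigzag< (toℕ i) (toℕ<n i))
    (λ {i} {j} eq → toℕ-injective (zigzag-injective (toℕ i) (toℕ j) (toℕ<n i) (toℕ<n j) eq))

module _ {M : ℕ} where

  private
    transpose-matchˡ : (i j : Fin M) → transpose i j i ≡ j
    transpose-matchˡ i j rewrite dec-true (i Fin.≟ i) refl = refl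

    transpose-fixes : {i j k : Fin M} → k ≢ i → k ≢ j → transpose i j k ≡ k
    transpose-fixes {i} {j} {k} k≢i k≢j rewrite dec-false (k Fin.≟ i) k≢i | dec-false (k Fin.≟ j) k≢j = refl

    transpose-injective : (i j : Fin M) → Injective _≡_ _≡_ (transpose i j)
    transpose-injective i j eq =
      trans (sym (transpose-inverse j i)) (trans (cong (transpose j i) eq) (transpose-inverse j i))

  extend-injection : {src tgt : Fin k → Fin M} → Injective _≡_ _≡_ src → Injective _≡_ _≡_ tgt →
                     ∃ λ (σ : Fin M → Fin M) → Injective _≡_ _≡_ σ × ∀ i → σ (src i) ≡ tgt i
  extend-injection {zero}  _ _ = (λ x → x) , (λ eq → eq) , λ ()
  extend-injection {suc k} {src} {tgt} src-injective tgt-injective =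
    let (σ , σ-injective , σ-src) =
          extend-injection (Fin.suc-injective ∘ src-injective) (Fin.suc-injective ∘ tgt-injective)
        τ = transpose (σ (src zero)) (tgt zero)
        τσ-src : ∀ i → τ (σ (src i)) ≡ tgt i
        τσ-src = λ
          { zero    → transpose-matchˡ (σ (src zero)) (tgt zero)
          ; (suc i) → trans (cong τ (σ-src i)) (transpose-fixes
              (λ eq → Fin.0≢1+n (sym (src-injective (σ-injective (trans (σ-src i) eq)))))
              (λ eq → Fin.0≢1+n (sym (tgt-injective eq))))
          }
    in τ ∘ σ , σ-injective ∘ transpose-injective _ _ , τσ-src

module _ (G : Graph) (t : ℕ) where

  adj-∪K₁ : (x y : Fin (p G)) → adj (G ∪K₁ t) (x ↑ˡ t) (y ↑ˡ t) ≡ adj G x y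
  adj-∪K₁ x y rewrite splitAt-↑ˡ (p G) x t | splitAt-↑ˡ (p G) y t = refl

  adj-∪K₁⁻¹ : ∀ x y → adj (G ∪K₁ t) x y ≡ true →
              ∃ λ x' → ∃ λ y' → x' ↑ˡ t ≡ x × y' ↑ˡ t ≡ y × adj G x' y' ≡ true
  adj-∪K₁⁻¹ x y xy with splitAt (p G) x in x≡ | splitAt (p G) y in y≡
  ... | inj₁ x' | inj₁ y' = x' , y' , splitAt⁻¹-↑ˡ x≡ , splitAt⁻¹-↑ˡ y≡ , xy
  ... | inj₁ _  | inj₂ _  = contradiction xy λ ()
  ... | inj₂ _  | _       = contradiction xy λ ()

  liftEdge : Edge G → Edge (G ∪K₁ t)
  liftEdge ((x , y) , x<y , xy) =
    (x ↑ˡ t , y ↑ˡ t) , subst₂ _<_ (sym (toℕ-↑ˡ x t)) (sym (toℕ-↑ˡ y t)) x<y , trans (adj-∪K₁ x y) xy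

  edges-∪K₁ : Edge G ⤖ Edge (G ∪K₁ t)
  edges-∪K₁ = mk⤖ (liftEdge-injective , strictlySurjective⇒surjective liftEdge-onto)
    where
    liftEdge-injective : Injective _≡_ _≡_ liftEdge
    liftEdge-injective {(x , y) , _} {(x' , y') , _} eq = edge-≡ (cong₂ _,_
      (↑ˡ-injective t x x' (cong (proj₁ ∘ proj₁) eq)) (↑ˡ-injective t y y' (cong (proj₂ ∘ proj₁) eq)))
    liftEdge-onto : StrictlySurjective _≡_ liftEdge
    liftEdge-onto ((x , y) , x<y , xy) =
      let (x' , y' , x'↑≡x , y'↑≡y , x'y') = adj-∪K₁⁻¹ x y xy
          toℕ-x' = trans (cong toℕ (sym x'↑≡x)) (toℕ-↑ˡ x' t)
          toℕ-y' = trans (cong toℕ (sym y'↑≡y)) (toℕ-↑ˡ y' t)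
      in ((x' , y') , subst₂ _<_ toℕ-x' toℕ-y' x<y , x'y') , edge-≡ (cong₂ _,_ x'↑≡x y'↑≡y)

consecutiveSums⇒superEdgeMagic-∪K₁ :
  {G : Graph} {t : ℕ} (ℓ : Fin (p G) → Fin (p G + t)) → Injective _≡_ _≡_ ℓ →
  Enumerates (edgeSum G (toℕ ∘ ℓ)) a k → IsSuperEdgeMagic (G ∪K₁ t)
consecutiveSums⇒superEdgeMagic-∪K₁ {G = G} {t} ℓ ℓ-injective e =
  let (σ , σ-injective , σ-extends) = extend-injection (↑ˡ-injective t _ _) ℓ-injective
  in consecutiveSums⇒superEdgeMagic (consecutiveSums σ-injective (enumerates-transport (edges-∪K₁ G t)
       (λ ((x , y) , _) → cong₂ (λ u w → toℕ u + toℕ w) (σ-extends x) (σ-extends y)) e))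

successor-adjacent : a < b → (⌊ suc a ≟ b ⌋ ∨ ⌊ suc b ≟ a ⌋) ≡ true → suc a ≡ b
successor-adjacent {a} {b} a<b adjacent with suc a ≟ b | suc b ≟ a
... | yes 1+a≡b | _        = 1+a≡b
... | no _      | yes 1+b≡a = contradiction (<-trans a<b (subst (b <_) 1+b≡a ≤-refl)) (<-irrefl refl)
... | no _      | no _      = contradiction adjacent λ ()

module PathJoin (n₂ m₂ : ℕ) where

  n₁ m₁ n m : ℕ
  n₁ = suc n₂
  m₁ = suc m₂
  n  = suc n₁
  m  = suc m₁

  G : Graph
  G = PathJoinEmpty n m

  u : Fin n → Fin (n + m)
  u i = i ↑ˡ m

  v : Fin m → Fin (n + m)
  v j = n ↑ʳ j

  u≢v : ∀ i j → u i ≢ v j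
  u≢v i j ui≡vj = <⇒≱ (toℕ<n i) (begin
    n              ≤⟨ m≤m+n n (toℕ j) ⟩
    n + toℕ j      ≡⟨ toℕ-↑ʳ n j ⟨
    toℕ (v j)      ≡⟨ cong toℕ ui≡vj ⟨
    toℕ (u i)      ≡⟨ toℕ-↑ˡ i m ⟩
    toℕ i          ∎)
    where open ≤-Reasoning

  adj-uv : ∀ i j → adj G (u i) (v j) ≡ true
  adj-uv i j rewrite splitAt-↑ˡ n i m | splitAt-↑ʳ n m j = refl

  adj-rung : ∀ k → adj G (u (Fin.inject₁ k)) (u (suc k)) ≡ true
  adj-rung k rewrite splitAt-↑ˡ n (Fin.inject₁ k) m | splitAt-↑ˡ n (suc k) m
                   | toℕ-inject₁ k | ≟-diag {suc (toℕ k)} refl = refl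

  spoke : Fin n → Fin m → Edge G
  spoke i j = (u i , v j) , u<v , adj-uv i j
    where
    u<v : toℕ (u i) < toℕ (v j)
    u<v = subst₂ _<_ (sym (toℕ-↑ˡ i m)) (sym (toℕ-↑ʳ n j)) (<-≤-trans (toℕ<n i) (m≤m+n n (toℕ j)))

  rung : Fin n₁ → Edge G
  rung k = (u (Fin.inject₁ k) , u (suc k)) , u<u , adj-rung k
    where
    u<u : toℕ (u (Fin.inject₁ k)) < toℕ (u (suc k))
    u<u = subst₂ _<_ (sym (trans (toℕ-↑ˡ (Fin.inject₁ k) m) (toℕ-inject₁ k)))
                     (sym (toℕ-↑ˡ (suc k) m)) ≤-refl

  -- ordered as the blocks of consecutive edge sums: spokes at v₀, path edges, spokes at v₁, v₂, …
  EdgeIndex : Set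
  EdgeIndex = Fin n ⊎ (Fin n₁ ⊎ (Fin n × Fin m₁))

  edgeAt : EdgeIndex → Edge G
  edgeAt (inj₁ i)             = spoke i zero
  edgeAt (inj₂ (inj₁ k))      = rung k
  edgeAt (inj₂ (inj₂ (i , j))) = spoke i (suc j)

  spokeIndex : Fin n → Fin m → EdgeIndex
  spokeIndex i zero    = inj₁ i
  spokeIndex i (suc j) = inj₂ (inj₂ (i , j))

  ends-spokeIndex : ∀ i j → proj₁ (edgeAt (spokeIndex i j)) ≡ (u i , v j)
  ends-spokeIndex i zero    = refl
  ends-spokeIndex i (suc j) = refl

  edge-cases : ∀ x y → x Fin.< y → adj G x y ≡ true →
               (∃ λ i → ∃ λ j → u i ≡ x × v j ≡ y) ⊎
               (∃ λ k → u (Fin.inject₁ k) ≡ x × u (suc k) ≡ y)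
  edge-cases x y x<y xy with splitAt n x in x≡ | splitAt n y in y≡
  ... | inj₂ _ | inj₂ _ = contradiction xy λ ()
  ... | inj₂ j | inj₁ i = contradiction (≤-trans (m≤m+n n (toℕ j)) (<⇒≤ vj<ui)) (<⇒≱ (toℕ<n i))
    where
    vj<ui : n + toℕ j < toℕ i
    vj<ui = subst₂ _<_ (trans (cong toℕ (sym (splitAt⁻¹-↑ʳ x≡))) (toℕ-↑ʳ n j))
                       (trans (cong toℕ (sym (splitAt⁻¹-↑ˡ y≡))) (toℕ-↑ˡ i m)) x<y
  ... | inj₁ i | inj₂ j = inj₁ (i , j , splitAt⁻¹-↑ˡ x≡ , splitAt⁻¹-↑ʳ y≡)
  ... | inj₁ i | inj₁ i' =
    let i<i' = subst₂ _<_ (trans (cong toℕ (sym (splitAt⁻¹-↑ˡ x≡))) (toℕ-↑ˡ i m))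
                          (trans (cong toℕ (sym (splitAt⁻¹-↑ˡ y≡))) (toℕ-↑ˡ i' m)) x<y
        1+i≡i' = successor-adjacent i<i' xy
        i<n₁ : toℕ i < n₁
        i<n₁ = s≤s⁻¹ (subst (_< n) (sym 1+i≡i') (toℕ<n i'))
        k = fromℕ< i<n₁
    in inj₂ (k , trans (cong u (toℕ-injective (trans (toℕ-inject₁ k) (toℕ-fromℕ< i<n₁))))
                       (splitAt⁻¹-↑ˡ x≡)
               , trans (cong u (toℕ-injective (trans (cong suc (toℕ-fromℕ< i<n₁)) 1+i≡i')))
                       (splitAt⁻¹-↑ˡ y≡))

  edgeAt-⤖ : EdgeIndex ⤖ Edge G
  edgeAt-⤖ = mk⤖ (edgeAt-injective , strictlySurjective⇒surjective edgeAt-onto)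
    where
    u-injective : ∀ {i i'} → u i ≡ u i' → i ≡ i'
    u-injective = ↑ˡ-injective m _ _
    v-injective : ∀ {j j'} → v j ≡ v j' → j ≡ j'
    v-injective = ↑ʳ-injective n _ _
    edgeAt-injective : Injective _≡_ _≡_ edgeAt
    edgeAt-injective {z} {z'} eq = go z z' (cong (proj₁ ∘ proj₁) eq) (cong (proj₂ ∘ proj₁) eq)
      where
      go : ∀ z z' → proj₁ (proj₁ (edgeAt z)) ≡ proj₁ (proj₁ (edgeAt z')) →
                    proj₂ (proj₁ (edgeAt z)) ≡ proj₂ (proj₁ (edgeAt z')) → z ≡ z'
      go (inj₁ i)              (inj₁ i')               first _      = cong inj₁ (u-injective first)
      go (inj₂ (inj₁ k))       (inj₂ (inj₁ k'))        _     second =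
        cong (inj₂ ∘ inj₁) (Fin.suc-injective (u-injective second))
      go (inj₂ (inj₂ (i , j))) (inj₂ (inj₂ (i' , j'))) first second =
        cong (inj₂ ∘ inj₂) (cong₂ _,_ (u-injective first) (Fin.suc-injective (v-injective second)))
      go (inj₁ _)              (inj₂ (inj₁ _))         _ second = contradiction (sym second) (u≢v _ _)
      go (inj₂ (inj₁ _))       (inj₁ _)                _ second = contradiction second (u≢v _ _)
      go (inj₂ (inj₁ _))       (inj₂ (inj₂ _))         _ second = contradiction second (u≢v _ _)
      go (inj₂ (inj₂ _))       (inj₂ (inj₁ _))         _ second = contradiction (sym second) (u≢v _ _)
      go (inj₁ _)              (inj₂ (inj₂ _))         _ second = contradiction (v-injective second) λ ()
      go (inj₂ (inj₂ _))       (inj₁ _)                _ second = contradiction (v-injective second) λ ()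
    edgeAt-onto : StrictlySurjective _≡_ edgeAt
    edgeAt-onto ((x , y) , x<y , xy) with edge-cases x y x<y xy
    ... | inj₁ (i , j , ui≡x , vj≡y) =
      spokeIndex i j , edge-≡ (trans (ends-spokeIndex i j) (cong₂ _,_ ui≡x vj≡y))
    ... | inj₂ (k , uk≡x , uk+1≡y)   = inj₂ (inj₁ k) , edge-≡ (cong₂ _,_ uk≡x uk+1≡y)

  uLabel : Fin n → ℕ
  uLabel i = ⌊ n /2⌋ + zigzag ⌈ n /2⌉ (toℕ i)

  vLabel : Fin m → ℕ
  vLabel zero    = 0
  vLabel (suc j) = n₁ + n * suc (toℕ j)

  vertexLabel : Fin (n + m) → ℕ
  vertexLabel x = [ uLabel , vLabel ]′ (splitAt n x)

  vertexLabel-u : ∀ i → vertexLabel (u i) ≡ uLabel i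
  vertexLabel-u i = cong [ uLabel , vLabel ]′ (splitAt-↑ˡ n i m)

  vertexLabel-v : ∀ j → vertexLabel (v j) ≡ vLabel j
  vertexLabel-v j = cong [ uLabel , vLabel ]′ (splitAt-↑ʳ n m j)

  uLabel< : ∀ i → uLabel i < n₁ + n
  uLabel< i = +-mono-≤-< (s≤s⁻¹ (⌊n/2⌋<n n₁)) (zigzag< n (toℕ i) (toℕ<n i))

  uLabel<vLabel : ∀ i j → uLabel i < vLabel (suc j)
  uLabel<vLabel i j = <-≤-trans (uLabel< i) (+-monoʳ-≤ n₁ (m≤m*n n (suc (toℕ j))))

  vertexLabel-injective : Injective _≡_ _≡_ vertexLabel
  vertexLabel-injective {x} {y} eq = trans (sym (join-splitAt n m x))
    (trans (cong (Fin.join n m) (labels-injective (splitAt n x) (splitAt n y) eq)) (join-splitAt n m y))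
    where
    labels-injective : ∀ w w' → [ uLabel , vLabel ]′ w ≡ [ uLabel , vLabel ]′ w' → w ≡ w'
    labels-injective (inj₁ i) (inj₁ i') eq =
      cong inj₁ (injective (zigzag-enumerates n) (+-cancelˡ-≡ ⌊ n /2⌋ _ _ eq))
    labels-injective (inj₂ zero)    (inj₂ zero)     _  = refl
    labels-injective (inj₂ (suc j)) (inj₂ (suc j')) eq =
      cong (inj₂ ∘ suc) (toℕ-injective (suc-injective (*-cancelˡ-≡ _ _ n (+-cancelˡ-≡ n₁ _ _ eq))))
    labels-injective (inj₂ zero)    (inj₂ (suc _))  eq = contradiction eq λ ()
    labels-injective (inj₂ (suc _)) (inj₂ zero)     eq = contradiction eq λ ()
    labels-injective (inj₁ _)       (inj₂ zero)     eq = contradiction eq λ ()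
    labels-injective (inj₂ zero)    (inj₁ _)        eq = contradiction eq λ ()
    labels-injective (inj₁ i)       (inj₂ (suc j))  eq = contradiction eq (<⇒≢ (uLabel<vLabel i j))
    labels-injective (inj₂ (suc j)) (inj₁ i)        eq = contradiction (sym eq) (<⇒≢ (uLabel<vLabel i j))

  vertexLabel< : ∀ x → vertexLabel x < n * m
  vertexLabel< x with splitAt n x
  ... | inj₁ i       = <-≤-trans (uLabel< i) (begin
    n₁ + n         ≤⟨ +-monoˡ-≤ n (n≤1+n n₁) ⟩
    n + n          ≤⟨ +-monoʳ-≤ n (m≤m*n n m₁) ⟩
    n + n * m₁     ≡⟨ *-suc n m₁ ⟨
    n * m          ∎)
    where open ≤-Reasoning
  ... | inj₂ zero    = z<s
  ... | inj₂ (suc j) = begin-strict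
    n₁ + n * suc (toℕ j)         <⟨ +-monoˡ-< (n * suc (toℕ j)) (n<1+n n₁) ⟩
    n + n * suc (toℕ j)          ≡⟨ *-suc n (suc (toℕ j)) ⟨
    n * suc (suc (toℕ j))        ≤⟨ *-monoʳ-≤ n (s≤s (toℕ<n j)) ⟩
    n * m                        ∎
    where open ≤-Reasoning

  reducedSum : EdgeIndex → ℕ
  reducedSum (inj₁ i)              = zigzag ⌈ n /2⌉ (toℕ i)
  reducedSum (inj₂ (inj₁ k))       = toℕ k + n
  reducedSum (inj₂ (inj₂ (i , j))) = zigzag ⌈ n /2⌉ (toℕ i) + n * toℕ j + (n + n₁)

  reducedSums : Enumerates reducedSum 0 (n + (n₁ + m₁ * n))
  reducedSums = enumerates-resp (λ { (inj₁ _) → refl ; (inj₂ (inj₁ _)) → refl ; (inj₂ (inj₂ _)) → refl })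
    (enumerates-⊎ (zigzag-enumerates n)
      (enumerates-⊎ (enumerates-+ʳ toℕ-enumerates)
                    (enumerates-+ʳ (enumerates-× (zigzag-enumerates n) toℕ-enumerates))))

  edgeAt-sum : ∀ z → edgeSum G vertexLabel (edgeAt z) ≡ reducedSum z + ⌊ n /2⌋
  edgeAt-sum (inj₁ i) rewrite vertexLabel-u i | vertexLabel-v zero =
    trans (+-identityʳ (uLabel i)) (+-comm ⌊ n /2⌋ _)
  edgeAt-sum (inj₂ (inj₁ k)) rewrite vertexLabel-u (Fin.inject₁ k) | vertexLabel-u (suc k) | toℕ-inject₁ k = begin
    ⌊ n /2⌋ + zigzag ⌈ n /2⌉ (toℕ k) + (⌊ n /2⌋ + zigzag ⌈ n /2⌉ (suc (toℕ k)))
      ≡⟨ rearrange ⌊ n /2⌋ (zigzag ⌈ n /2⌉ (toℕ k)) (zigzag ⌈ n /2⌉ (suc (toℕ k))) ⟩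
    ⌊ n /2⌋ + (zigzag ⌈ n /2⌉ (toℕ k) + zigzag ⌈ n /2⌉ (suc (toℕ k))) + ⌊ n /2⌋
      ≡⟨ cong (λ t → ⌊ n /2⌋ + t + ⌊ n /2⌋) (zigzag-+-suc ⌈ n /2⌉ (toℕ k)) ⟩
    ⌊ n /2⌋ + (toℕ k + ⌈ n /2⌉) + ⌊ n /2⌋
      ≡⟨ cong (_+ ⌊ n /2⌋) (x+[y+z]≡y+[x+z] ⌊ n /2⌋ (toℕ k) ⌈ n /2⌉) ⟩
    toℕ k + (⌊ n /2⌋ + ⌈ n /2⌉) + ⌊ n /2⌋
      ≡⟨ cong (λ t → toℕ k + t + ⌊ n /2⌋) (⌊n/2⌋+⌈n/2⌉≡n n) ⟩
    toℕ k + n + ⌊ n /2⌋ ∎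
    where
    open ≡-Reasoning
    rearrange : ∀ f a b → f + a + (f + b) ≡ f + (a + b) + f
    rearrange = solve-∀
  edgeAt-sum (inj₂ (inj₂ (i , j))) rewrite vertexLabel-u i | vertexLabel-v (suc j) | *-suc n (toℕ j) =
    rearrange ⌊ n /2⌋ (zigzag ⌈ n /2⌉ (toℕ i)) n n₁ (n * toℕ j)
    where
    rearrange : ∀ f z n n₁ nj → f + z + (n₁ + (n + nj)) ≡ z + nj + (n + n₁) + f
    rearrange = solve-∀

  isolated : ℕ
  isolated = n₁ * m₁ ∸ 1

  vertexLabelᶠ : Fin (n + m) → Fin (n + m + isolated)
  vertexLabelᶠ x = fromℕ< (subst (vertexLabel x <_) (sym order) (vertexLabel< x))
    where
    order : n + m + isolated ≡ n * m
    order = arithmetic n₂ m₂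
      where
      arithmetic : ∀ a b → 2 + a + (2 + b) + (b + a * suc b) ≡ (2 + a) * (2 + b)
      arithmetic = solve-∀

  toℕ-vertexLabelᶠ : ∀ x → toℕ (vertexLabelᶠ x) ≡ vertexLabel x
  toℕ-vertexLabelᶠ x = toℕ-fromℕ< _

  superEdgeMagic : IsSuperEdgeMagic (G ∪K₁ isolated)
  superEdgeMagic = consecutiveSums⇒superEdgeMagic-∪K₁ vertexLabelᶠ
    (λ {x} {y} eq → vertexLabel-injective
      (trans (sym (toℕ-vertexLabelᶠ x)) (trans (cong toℕ eq) (toℕ-vertexLabelᶠ y))))
    (enumerates-transport edgeAt-⤖ (λ z → trans (edgeSumᶠ (edgeAt z)) (edgeAt-sum z)) (enumerates-+ʳ reducedSums))
    where
    edgeSumᶠ : ∀ e → edgeSum G (toℕ ∘ vertexLabelᶠ) e ≡ edgeSum G vertexLabel e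
    edgeSumᶠ ((x , y) , _) = cong₂ _+_ (toℕ-vertexLabelᶠ x) (toℕ-vertexLabelᶠ y)

  deficiency≥ : ∀ t → IsSuperEdgeMagic (G ∪K₁ t) → ⌈ n₂ * m₁ /2⌉ ≤ t
  deficiency≥ t sem = subst (⌈ n₂ * m₁ /2⌉ ≤_) (sym (n≡⌈n+n/2⌉ t))
    (⌈n/2⌉-mono (+-cancelʳ-≤ _ _ _ (subst₂ _≤_ (edges n₂ m₂) (vertices n₂ m₂ t)
      (superEdgeMagic⇒edges≤ sem edge edge-injective))))
    where
    counted : Fin (n + (n₁ + m₁ * n)) ⤖ EdgeIndex
    counted = ⤖-sym (enumerates⇒⤖ reducedSums)
    edge : Fin (n + (n₁ + m₁ * n)) → Edge (G ∪K₁ t)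
    edge = Bijection.to (edges-∪K₁ G t) ∘ edgeAt ∘ Bijection.to counted
    edge-injective : Injective _≡_ _≡_ edge
    edge-injective =
      Bijection.injective counted ∘ Bijection.injective edgeAt-⤖ ∘ Bijection.injective (edges-∪K₁ G t)
    edges : ∀ a b → 2 + a + (1 + a + (1 + b) * (2 + a)) + 3 ≡ a * (1 + b) + (8 + 2 * a + 2 * b)
    edges = solve-∀
    vertices : ∀ a b t → 2 + a + (2 + b) + t + (2 + a + (2 + b) + t) ≡ t + t + (8 + 2 * a + 2 * b)
    vertices = solve-∀

theorem3 : ∀ (n m : ℕ) → 3 ≤ n → 3 ≤ m →
    ∃ λ μ → SuperEdgeMagicDeficiency (PathJoinEmpty n m) μ
          × ⌈ (n ∸ 2) * (m ∸ 1) /2⌉ ≤ μ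
          × μ ≤ (n ∸ 1) * (m ∸ 1) ∸ 1
theorem3 _ _ (s≤s (s≤s (s≤s {n = a} _))) (s≤s (s≤s (s≤s {n = b} _))) =
  let open PathJoin (suc a) (suc b)
      (μ , μ≤isolated , superEdgeMagic-μ , below-μ) = least (λ s → superEdgeMagic? (G ∪K₁ s)) superEdgeMagic
  in μ , (superEdgeMagic-μ , below-μ) , deficiency≥ μ superEdgeMagic-μ , μ≤isolated
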